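{- If $A$ is a minimally nonideal clutter matrix whose core is the point-line incidence matrix of the Fano plane $\mathrm{PG}(2,2)$, then $A$ is square.
   Context: A clutter $\mathcal{C}=(V,E)$ is a finite set $V$ with a family $E$ of subsets of $V$ (hyperedges) none containing another; its clutter matrix has a row for each hyperedge (its incidence vector) and a column for each vertex. $\mathcal{C}$ (or its matrix $A$, of size $m\times n$) is ideal if the polyhedron $\{x\in\mathbb{R}^n: Ax\ge\mathbf{1},\ x\ge\mathbf{0}\}$ has only integral vertices. Deletion $\mathcal{C}\backslash v$: vertex set $V\setminus\{v\}$, hyperedges those of $\mathcal{C}$ not containing $v$. Contraction $\mathcal{C}/v$: vertex set $V\setminus\{v\}$, hyperedges the inclusion-minimal sets $H\setminus\{v\}$, $H\in E$. Minors are obtained by sequences of deletions and contractions. $\mathcal{C}$ is minimally nonideal if it is not ideal but every proper minor is ideal. The core of $A$ is the submatrix formed by its rows of minimum weight (number of ones); "the core is the point-line incidence matrix of a projective plane" means the vertices are the points and the minimum-cardinality hyperedges are exactly the lines.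
   Formalization: The polyhedron in the definition of ideal, given by Ax ≥ 1 and x ≥ 0, is taken over ℚ^n rather than ℝ^n, so its vertices are points with rational coordinates. -}

module Defs where

open import Data.Bool using (Bool; true; false; if_then_else_)
import Data.Bool as Bool
open import Data.Nat using (ℕ; zero; suc) renaming (_≤_ to _≤ℕ_)
open import Data.Fin using (Fin)
import Data.Fin as F
open import Data.Fin.Subset using (Subset; _∈_; _∉_; _⊆_; ∣_∣; inside; outside)
open import Data.Fin.Subset.Properties using (_∈?_; _⊆?_)
open import Data.Vec using (Vec; []; _∷_; removeAt; tabulate)
import Data.Vec
open import Data.Vec.Properties using (≡-dec)
open import Data.List using (List; []; _∷_; map; filter; deduplicate; length)
open import Data.List.Membership.Propositional renaming (_∈_ to _∈ₗ_)
open import Data.List.Relation.Unary.All using (All; all?)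
open import Data.List.Relation.Unary.Unique.Propositional using (Unique)
open import Data.Integer using (ℤ)
open import Data.Rational using (ℚ; 0ℚ; 1ℚ; ½; _+_; _*_; _≤_; _/_)
open import Data.Product using (Σ; ∃; _×_; _,_)
open import Function.Bundles using (Inverse; _↔_)
open import Relation.Binary.PropositionalEquality using (_≡_; _≢_)
open import Relation.Nullary using (¬_; ¬?; Dec; yes; no; _×-dec_)

Family : ℕ → Set
Family n = List (Subset n)

-- A clutter on vertex set Fin n: a duplicate-free list of hyperedges,
-- none containing another.  Its clutter matrix has one row per element.
record Clutter (n : ℕ) : Set where
  field
    edges    : Family n
    distinct : Unique edges
    antichain : ∀ {H H'} → H ∈ₗ edges → H' ∈ₗ edges → H ⊆ H' → H ≡ H'

deleteV : ∀ {n} → Fin (suc n) → Family (suc n) → Family n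
deleteV v F = map (λ H → removeAt H v) (filter (λ H → ¬? (v ∈? H)) F)

_≟ˢ_ : ∀ {n} (p q : Subset n) → Dec (p ≡ q)
_≟ˢ_ = ≡-dec Bool._≟_

_⊊_ : ∀ {n} → Subset n → Subset n → Set
p ⊊ q = p ⊆ q × ¬ (p ≡ q)

_⊊?_ : ∀ {n} (p q : Subset n) → Dec (p ⊊ q)
p ⊊? q = (p ⊆? q) ×-dec ¬? (p ≟ˢ q)

minimalMembers : ∀ {n} → Family n → Family n
minimalMembers F = filter (λ H → all? (λ H' → ¬? (H' ⊊? H)) F) F

contractV : ∀ {n} → Fin (suc n) → Family (suc n) → Family n
contractV v F =
  minimalMembers (deduplicate _≟ˢ_ (map (λ H → removeAt H v) F))

data ProperMinor : ∀ {n k} → Family n → Family k → Set where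
  del  : ∀ {n} (F : Family (suc n)) (v : Fin (suc n)) → ProperMinor F (deleteV v F)
  con  : ∀ {n} (F : Family (suc n)) (v : Fin (suc n)) → ProperMinor F (contractV v F)
  delS : ∀ {n k} {F : Family n} {G : Family (suc k)} →
         ProperMinor F G → (v : Fin (suc k)) → ProperMinor F (deleteV v G)
  conS : ∀ {n k} {F : Family n} {G : Family (suc k)} →
         ProperMinor F G → (v : Fin (suc k)) → ProperMinor F (contractV v G)

Point : ℕ → Set
Point n = Fin n → ℚ

rowSum : ∀ {n} → Subset n → Point n → ℚ
rowSum {zero}  []      x = 0ℚ
rowSum {suc n} (b ∷ H) x =
  (if b then x F.zero else 0ℚ) + rowSum H (λ i → x (F.suc i))

InPolyhedron : ∀ {n} → Family n → Point n → Set
InPolyhedron F x = (∀ i → 0ℚ ≤ x i) × All (λ H → 1ℚ ≤ rowSum H x) F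

IsVertex : ∀ {n} → Family n → Point n → Set
IsVertex F x =
  InPolyhedron F x ×
  (∀ y z → InPolyhedron F y → InPolyhedron F z →
     (∀ i → x i ≡ ½ * (y i + z i)) → ∀ i → y i ≡ z i)

IsIntegral : ∀ {n} → Point n → Set
IsIntegral x = ∀ i → ∃ λ (k : ℤ) → x i ≡ k / 1

Ideal : ∀ {n} → Family n → Set
Ideal F = ∀ x → IsVertex F x → IsIntegral x

MinimallyNonideal : ∀ {n} → Family n → Set
MinimallyNonideal {n} F =
  ¬ Ideal F × (∀ {k} (G : Family k) → ProperMinor F G → Ideal G)

InCore : ∀ {n} → Family n → Subset n → Set
InCore F H = H ∈ₗ F × (∀ {H'} → H' ∈ₗ F → ∣ H ∣ ≤ℕ ∣ H' ∣)

-- lines of PG(2,2) on points Fin 7: {i, i+1, i+3} mod 7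
fanoLines : List (Subset 7)
fanoLines =
    (inside  ∷ inside  ∷ outside ∷ inside  ∷ outside ∷ outside ∷ outside ∷ [])
  ∷ (outside ∷ inside  ∷ inside  ∷ outside ∷ inside  ∷ outside ∷ outside ∷ [])
  ∷ (outside ∷ outside ∷ inside  ∷ inside  ∷ outside ∷ inside  ∷ outside ∷ [])
  ∷ (outside ∷ outside ∷ outside ∷ inside  ∷ inside  ∷ outside ∷ inside  ∷ [])
  ∷ (inside  ∷ outside ∷ outside ∷ outside ∷ inside  ∷ inside  ∷ outside ∷ [])
  ∷ (outside ∷ inside  ∷ outside ∷ outside ∷ outside ∷ inside  ∷ inside  ∷ [])
  ∷ (inside  ∷ outside ∷ inside  ∷ outside ∷ outside ∷ outside ∷ inside  ∷ [])
  ∷ []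

relabel : ∀ {n} → Fin 7 ↔ Fin n → Subset 7 → Subset n
relabel σ L = tabulate (λ j → Data.Vec.lookup L (Inverse.from σ j))

CoreIsFano : ∀ {n} → Family n → Set
CoreIsFano {n} F =
  Σ (Fin 7 ↔ Fin n) λ σ →
    (∀ H → InCore F H → ∃ λ L → L ∈ₗ fanoLines × H ≡ relabel σ L) ×
    (∀ L → L ∈ₗ fanoLines → InCore F (relabel σ L))

-- Label the seven points so that the minimum-weight hyperedges are the lines {i, i+1, i+3} (mod 7)
-- of the Fano plane.  Every hyperedge has at least three points, one with exactly three is a line,
-- and no hyperedge properly contains a line; checking all subsets of the seven points, each
-- hyperedge is then a line or a co-line (the complement of a line).  A co-line cannot be a
-- hyperedge.  Rotating the labels, it would be {2,4,5,6}; deleting point 0 leaves the hyperedges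
-- avoiding 0, all of them lines or co-lines and among them {1,2,4}, {2,3,5}, {3,4,6} and {2,4,5,6}.
-- The point x̂ = (1, 0, ½, 0, ½, ½) on the points 1,…,6 covers every line and co-line avoiding 0,
-- and it is the only point with x̂₂ = x̂₄ = 0 on which those four rows are tight, so it is a
-- fractional vertex and the deletion is not ideal.  Hence the hyperedges are exactly the seven
-- lines.

module Submission where

open import Defs

open import Algebra.Bundles using (CommutativeMonoid)
import Algebra.Properties.CommutativeMonoid.Sum as Sum
open import Data.Bool using (true; false; if_then_else_)
open import Data.Empty using (⊥; ⊥-elim)
open import Data.Fin using (Fin; zero; suc; toℕ; punchIn; punchOut)
open import Data.Fin.Patterns using (0F; 1F; 2F; 3F; 4F; 5F; 6F)
open import Data.Fin.Permutation
  using (Permutation; Permutation′; permutation; _⟨$⟩ʳ_; _⟨$⟩ˡ_; inverseˡ; inverseʳ; flip; _∘ₚ_; ↔⇒≡)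
import Data.Fin.Properties as Fin
open import Data.Fin.Subset using (Subset; _⊆_; _∈_; _∉_; ∣_∣; ∁; inside; outside)
open import Data.Fin.Subset.Properties using (_∈?_; _⊆?_)
import Data.Integer as ℤ
open import Data.List using (List; []; _∷_; map; _++_; length) renaming (lookup to _!_)
open import Data.List.Membership.Propositional using () renaming (_∈_ to _∈ₗ_)
open import Data.List.Membership.DecPropositional (_≟ˢ_ {7}) using () renaming (_∈?_ to _∈ₗ?_)
open import Data.List.Membership.Propositional.Properties
  using (∈-map⁺; ∈-map⁻; ∈-++⁻; ∈-filter⁺; ∈-map∘filter⁻)
open import Data.List.Membership.Propositional.Properties.WithK using (unique∧set⇒bag)
open import Data.List.Relation.Binary.BagAndSetEquality using (∼bag⇒↭)
open import Data.List.Relation.Binary.Permutation.Propositional.Properties using (↭-length)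
open import Data.List.Relation.Binary.Subset.Propositional using () renaming (_⊆_ to _⊆ₗ_)
open import Data.List.Relation.Unary.All as All using (All; []; _∷_)
import Data.List.Relation.Unary.All.Properties as Allₚ
open import Data.List.Relation.Unary.Any using (here; there)
open import Data.List.Relation.Unary.Unique.Propositional using (Unique)
import Data.List.Relation.Unary.Unique.Propositional.Properties as Unique
open import Data.List.Relation.Unary.Unique.DecPropositional (_≟ˢ_ {7}) using (unique?)
open import Data.Nat using (zero; suc; _∸_; _≟_) renaming (_+_ to _+ℕ_; _≤_ to _≤ℕ_; _≤?_ to _≤ℕ?_)
open import Data.Nat.DivMod using (_mod_)
import Data.Nat.Coprimality as Coprime
import Data.Nat.Properties as ℕ
open import Data.Product using (∃; _×_; _,_; proj₁; proj₂)
open import Data.Rational using (ℚ; 0ℚ; 1ℚ; ½; _+_; _*_; _-_; -_; _/_; ↧ₙ_; _≤_)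
import Data.Rational.Properties as ℚ
open import Algebra.Properties.CommutativeSemigroup
  (CommutativeMonoid.commutativeSemigroup ℚ.+-0-commutativeMonoid) using (interchange)
open import Data.Rational.Solver using (module +-*-Solver)
open import Data.Sum using ([_,_]′)
open import Data.Vec using ([]; _∷_; lookup; removeAt)
open import Data.Vec.Properties using (lookup∘tabulate; tabulate∘lookup; tabulate-cong; []=⇒lookup; lookup⇒[]=)
import Data.Vec.Functional as Vector
open import Data.Vec.Functional.Properties
  using (insertAt-lookup; insertAt-punchIn; insertAt-removeAt; removeAt-punchOut)
open import Function using (_∘_; mk⇔)
open import Relation.Binary.PropositionalEquality
open import Relation.Nullary using (Dec; ¬_; ¬?; yes; no; _→-dec_; _×-dec_; map′)
open import Relation.Nullary.Decidable using (from-yes)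
open import Relation.Unary using (Pred; Decidable)

lookup-relabel : ∀ {n} (π : Permutation 7 n) A j → lookup (relabel π A) j ≡ lookup A (π ⟨$⟩ˡ j)
lookup-relabel π A = lookup∘tabulate (lookup A ∘ (π ⟨$⟩ˡ_))

lookup-relabel-⟨$⟩ʳ : ∀ {n} (π : Permutation 7 n) A i → lookup (relabel π A) (π ⟨$⟩ʳ i) ≡ lookup A i
lookup-relabel-⟨$⟩ʳ π A i = trans (lookup-relabel π A (π ⟨$⟩ʳ i)) (cong (lookup A) (inverseˡ π))

∈-relabel⁺ : ∀ {n} (π : Permutation 7 n) {A i} → i ∈ A → π ⟨$⟩ʳ i ∈ relabel π A
∈-relabel⁺ π {A} {i} i∈A = lookup⇒[]= _ _ (trans (lookup-relabel-⟨$⟩ʳ π A i) ([]=⇒lookup i∈A))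

∈-relabel⁻ : ∀ {n} (π : Permutation 7 n) {A i} → π ⟨$⟩ʳ i ∈ relabel π A → i ∈ A
∈-relabel⁻ π {A} {i} i∈πA = lookup⇒[]= _ _ (trans (sym (lookup-relabel-⟨$⟩ʳ π A i)) ([]=⇒lookup i∈πA))

relabel-mono : ∀ {n} (π : Permutation 7 n) {A B} → A ⊆ B → relabel π A ⊆ relabel π B
relabel-mono π {A} {B} A⊆B {j} j∈πA = subst (_∈ relabel π B) (inverseʳ π)
  (∈-relabel⁺ π (A⊆B (∈-relabel⁻ π (subst (_∈ relabel π A) (sym (inverseʳ π)) j∈πA))))

relabel-∘ₚ : (π ρ : Permutation′ 7) → ∀ A → relabel (π ∘ₚ ρ) A ≡ relabel ρ (relabel π A)
relabel-∘ₚ π ρ A = tabulate-cong λ j → sym (lookup-relabel π A (ρ ⟨$⟩ˡ j))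

relabel-flip : (π : Permutation′ 7) → ∀ A → relabel (flip π) (relabel π A) ≡ A
relabel-flip π A = trans (tabulate-cong (lookup-relabel-⟨$⟩ʳ π A)) (tabulate∘lookup A)

relabel-flip′ : (π : Permutation′ 7) → ∀ A → relabel π (relabel (flip π) A) ≡ A
relabel-flip′ π = relabel-flip (flip π)

relabel-injective : (π : Permutation′ 7) → ∀ {A B} → relabel π A ≡ relabel π B → A ≡ B
relabel-injective π {A} {B} eq =
  trans (sym (relabel-flip π A)) (trans (cong (relabel (flip π)) eq) (relabel-flip π B))

module _ {c ℓ} (M : CommutativeMonoid c ℓ) where

  open CommutativeMonoid M using (Carrier; ε; _≈_) renaming (trans to ≈-trans; reflexive to ≈-reflexive)
  open Sum M using (sum; sum-permute; sum-cong-≗)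

  sumOver : ∀ {n} → Subset n → (Fin n → Carrier) → Carrier
  sumOver A f = sum (λ i → if lookup A i then f i else ε)

  sumOver-relabel : ∀ {n} (π : Permutation 7 n) A f → sumOver (relabel π A) f ≈ sumOver A (f ∘ (π ⟨$⟩ʳ_))
  sumOver-relabel π A f = ≈-trans (sum-permute _ π) (≈-reflexive (sum-cong-≗ λ i →
    cong (λ b → if b then f (π ⟨$⟩ʳ i) else ε) (lookup-relabel-⟨$⟩ʳ π A i)))

∣∣≡sumOver : ∀ {n} (A : Subset n) → ∣ A ∣ ≡ sumOver ℕ.+-0-commutativeMonoid A (λ _ → 1)
∣∣≡sumOver []          = refl
∣∣≡sumOver (true ∷ A)  = cong suc (∣∣≡sumOver A)
∣∣≡sumOver (false ∷ A) = ∣∣≡sumOver A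

∣relabel∣ : ∀ {n} (π : Permutation 7 n) A → ∣ relabel π A ∣ ≡ ∣ A ∣
∣relabel∣ π A = trans (∣∣≡sumOver (relabel π A))
  (trans (sumOver-relabel ℕ.+-0-commutativeMonoid π A _) (sym (∣∣≡sumOver A)))

rowSum≡sumOver : ∀ {n} (H : Subset n) x → rowSum H x ≡ sumOver ℚ.+-0-commutativeMonoid H x
rowSum≡sumOver []      x = refl
rowSum≡sumOver (b ∷ H) x = cong ((if b then x zero else 0ℚ) +_) (rowSum≡sumOver H (x ∘ suc))

rowSum-cong : ∀ {n} (H : Subset n) {x y} → x ≗ y → rowSum H x ≡ rowSum H y
rowSum-cong []      x≗y = refl
rowSum-cong (b ∷ H) x≗y =
  cong₂ _+_ (cong (λ t → if b then t else 0ℚ) (x≗y zero)) (rowSum-cong H (x≗y ∘ suc))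

rowSum-relabel : ∀ {n} (π : Permutation 7 n) A x → rowSum (relabel π A) x ≡ rowSum A (x ∘ (π ⟨$⟩ʳ_))
rowSum-relabel π A x = trans (rowSum≡sumOver (relabel π A) x)
  (trans (sumOver-relabel ℚ.+-0-commutativeMonoid π A x) (sym (rowSum≡sumOver A _)))

rowSum-relabel-⟨$⟩ˡ : ∀ {n} (π : Permutation 7 n) A x →
                      rowSum (relabel π A) (x ∘ (π ⟨$⟩ˡ_)) ≡ rowSum A x
rowSum-relabel-⟨$⟩ˡ π A x = trans (rowSum-relabel π A _) (rowSum-cong A λ i → cong x (inverseˡ π))

rowSum-removeAt : ∀ {n} (H : Subset (suc n)) v y →
                  rowSum (removeAt H v) y ≡ rowSum H (Vector.insertAt y v 0ℚ)
rowSum-removeAt (true  ∷ H)     zero    y = sym (ℚ.+-identityˡ _)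
rowSum-removeAt (false ∷ H)     zero    y = sym (ℚ.+-identityˡ _)
rowSum-removeAt (b ∷ H@(_ ∷ _)) (suc v) y = cong ((if b then y zero else 0ℚ) +_) (rowSum-removeAt H v (y ∘ suc))

½*-+-interchange : ∀ p q r s → ½ * (p + q) + ½ * (r + s) ≡ ½ * ((p + r) + (q + s))
½*-+-interchange p q r s = trans (sym (ℚ.*-distribˡ-+ ½ (p + q) (r + s))) (cong (½ *_) (interchange p q r s))

rowSum-midpoint : ∀ {n} (H : Subset n) {x y z} → (∀ i → x i ≡ ½ * (y i + z i)) →
                  rowSum H x ≡ ½ * (rowSum H y + rowSum H z)
rowSum-midpoint []                      mid = refl
rowSum-midpoint (true  ∷ H) {y = y} {z} mid = trans (cong₂ _+_ (mid zero) (rowSum-midpoint H (mid ∘ suc)))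
  (½*-+-interchange (y zero) (z zero) (rowSum H (y ∘ suc)) (rowSum H (z ∘ suc)))
rowSum-midpoint (false ∷ H) {y = y} {z} mid = trans (cong (0ℚ +_) (rowSum-midpoint H (mid ∘ suc)))
  (½*-+-interchange 0ℚ 0ℚ (rowSum H (y ∘ suc)) (rowSum H (z ∘ suc)))

½*p+½*p≡p : ∀ p → ½ * p + ½ * p ≡ p
½*p+½*p≡p p = trans (sym (ℚ.*-distribʳ-+ p ½ ½)) (ℚ.*-identityˡ p)

midpoint-at-lower-bound : ∀ {a b c} → c ≤ a → c ≤ b → c ≡ ½ * (a + b) → a ≡ c × b ≡ c
midpoint-at-lower-bound {a} {b} {c} c≤a c≤b c≡mid =
    ℚ.≤-antisym (ℚ.≮⇒≥ λ c<a → ℚ.<-irrefl c+c≡a+b (ℚ.+-mono-<-≤ c<a c≤b)) c≤a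
  , ℚ.≤-antisym (ℚ.≮⇒≥ λ c<b → ℚ.<-irrefl c+c≡a+b (ℚ.+-mono-≤-< c≤a c<b)) c≤b
  where
  c+c≡a+b : c + c ≡ a + b
  c+c≡a+b = trans (cong₂ _+_ c≡mid c≡mid) (½*p+½*p≡p (a + b))

½≢integer : ∀ k → ½ ≢ k / 1
½≢integer (ℤ.+ m) ½≡k
  with () ← cong ↧ₙ_ (trans ½≡k (ℚ.normalize-coprime (Coprime.sym (Coprime.1-coprimeTo m))))
½≢integer ℤ.-[1+ m ] ½≡k
  with () ← cong ↧ₙ_ (trans ½≡k (cong -_ (ℚ.normalize-coprime (Coprime.sym (Coprime.1-coprimeTo (suc m))))))

-- Vertices of covering polyhedra

∀-punchIn : ∀ {n} {P : Fin (suc n) → Set} v → P v → (∀ j → P (punchIn v j)) → ∀ i → P i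
∀-punchIn {P = P} v Pv Pj i with v Fin.≟ i
... | yes refl = Pv
... | no  v≢i  = subst P (Fin.punchIn-punchOut v≢i) (Pj (punchOut v≢i))

∈-deleteV⁺ : ∀ {n} {F : Family (suc n)} {H} v → H ∈ₗ F → v ∉ H → removeAt H v ∈ₗ deleteV v F
∈-deleteV⁺ v H∈F v∉H = ∈-map⁺ (λ H → removeAt H v) (∈-filter⁺ (λ H → ¬? (v ∈? H)) H∈F v∉H)

∈-deleteV⁻ : ∀ {n} {F : Family (suc n)} {R} v → R ∈ₗ deleteV v F →
             ∃ λ H → H ∈ₗ F × v ∉ H × R ≡ removeAt H v
∈-deleteV⁻ v R∈
  with H , H∈F , R≡ , v∉H ← ∈-map∘filter⁻ (λ H → removeAt H v) (λ H → ¬? (v ∈? H)) R∈ =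
  H , H∈F , v∉H , R≡

deleteV-mono : ∀ {n} {F G : Family (suc n)} v → F ⊆ₗ G → deleteV v F ⊆ₗ deleteV v G
deleteV-mono v F⊆G R∈ with H , H∈F , v∉H , refl ← ∈-deleteV⁻ v R∈ = ∈-deleteV⁺ v (F⊆G H∈F) v∉H

InPolyhedron-antitone : ∀ {n} {F G : Family n} {x} → F ⊆ₗ G → InPolyhedron G x → InPolyhedron F x
InPolyhedron-antitone F⊆G (x≥0 , rows) = x≥0 , All.tabulate λ H∈F → All.lookup rows (F⊆G H∈F)

IsVertex-⊆ : ∀ {n} {F G : Family n} {x} → F ⊆ₗ G → InPolyhedron G x → IsVertex F x → IsVertex G x
IsVertex-⊆ F⊆G Px (_ , extreme) = Px , λ y z Py Pz →
  extreme y z (InPolyhedron-antitone F⊆G Py) (InPolyhedron-antitone F⊆G Pz)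

tight-unique⇒IsVertex : ∀ {n} {F : Family n} {x} → InPolyhedron F x →
  (∀ w → InPolyhedron F w → (∀ i → x i ≡ 0ℚ → w i ≡ 0ℚ) →
         (∀ {H} → H ∈ₗ F → rowSum H x ≡ 1ℚ → rowSum H w ≡ 1ℚ) → ∀ i → w i ≡ x i) →
  IsVertex F x
tight-unique⇒IsVertex {F = F} {x} Px unique = Px , λ y z Py Pz mid →
  let zeros : ∀ i → x i ≡ 0ℚ → y i ≡ 0ℚ × z i ≡ 0ℚ
      zeros i xᵢ≡0 = midpoint-at-lower-bound (proj₁ Py i) (proj₁ Pz i) (trans (sym xᵢ≡0) (mid i))
      rows : ∀ {H} → H ∈ₗ F → rowSum H x ≡ 1ℚ → rowSum H y ≡ 1ℚ × rowSum H z ≡ 1ℚ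
      rows {H} H∈F tight = midpoint-at-lower-bound (All.lookup (proj₂ Py) H∈F) (All.lookup (proj₂ Pz) H∈F)
                                                   (trans (sym tight) (rowSum-midpoint H mid))
      y≗x = unique y Py (λ i → proj₁ ∘ zeros i) (λ H∈F → proj₁ ∘ rows H∈F)
      z≗x = unique z Pz (λ i → proj₂ ∘ zeros i) (λ H∈F → proj₂ ∘ rows H∈F)
  in λ i → trans (y≗x i) (sym (z≗x i))

module _ {n} (π : Permutation 7 n) {F : Family 7} where

  InPolyhedron-relabel⁺ : ∀ {x} → InPolyhedron F x → InPolyhedron (map (relabel π) F) (x ∘ (π ⟨$⟩ˡ_))
  InPolyhedron-relabel⁺ {x} (x≥0 , rows) =
    x≥0 ∘ (π ⟨$⟩ˡ_) ,
    Allₚ.map⁺ (All.map (λ {H} → subst (1ℚ ≤_) (sym (rowSum-relabel-⟨$⟩ˡ π H x))) rows)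

  InPolyhedron-relabel⁻ : ∀ {y} → InPolyhedron (map (relabel π) F) y → InPolyhedron F (y ∘ (π ⟨$⟩ʳ_))
  InPolyhedron-relabel⁻ {y} (y≥0 , rows) =
    y≥0 ∘ (π ⟨$⟩ʳ_) , All.map (λ {H} → subst (1ℚ ≤_) (rowSum-relabel π H y)) (Allₚ.map⁻ rows)

  IsVertex-relabel : ∀ {x} → IsVertex F x → IsVertex (map (relabel π) F) (x ∘ (π ⟨$⟩ˡ_))
  IsVertex-relabel {x} (Px , extreme) = InPolyhedron-relabel⁺ Px , λ y z Py Pz mid j →
    let y∘π≗z∘π = extreme (y ∘ (π ⟨$⟩ʳ_)) (z ∘ (π ⟨$⟩ʳ_))
                          (InPolyhedron-relabel⁻ Py) (InPolyhedron-relabel⁻ Pz)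
                          (λ i → trans (cong x (sym (inverseˡ π))) (mid (π ⟨$⟩ʳ i)))
    in subst₂ _≡_ (cong y (inverseʳ π)) (cong z (inverseʳ π)) (y∘π≗z∘π (π ⟨$⟩ˡ j))

InPolyhedron-deleteV : ∀ {n} {F : Family (suc n)} {p} v → p v ≡ 0ℚ → (∀ i → 0ℚ ≤ p i) →
  (∀ {H} → H ∈ₗ F → v ∉ H → 1ℚ ≤ rowSum H p) → InPolyhedron (deleteV v F) (Vector.removeAt p v)
InPolyhedron-deleteV {F = F} {p} v pᵥ≡0 p≥0 rows = p≥0 ∘ punchIn v , All.tabulate feasible
  where
  reinsert : Vector.insertAt (Vector.removeAt p v) v 0ℚ ≗ p
  reinsert i = trans (cong (λ t → Vector.insertAt (Vector.removeAt p v) v t i) (sym pᵥ≡0)) (insertAt-removeAt p v i)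
  feasible : ∀ {R} → R ∈ₗ deleteV v F → 1ℚ ≤ rowSum R (Vector.removeAt p v)
  feasible R∈ with H , H∈F , v∉H , refl ← ∈-deleteV⁻ v R∈ = subst (1ℚ ≤_)
    (sym (trans (rowSum-removeAt H v (Vector.removeAt p v)) (rowSum-cong H reinsert))) (rows H∈F v∉H)

IsVertex-deleteV : ∀ {n} {F : Family (suc n)} {p} v → (∀ {H} → H ∈ₗ F → v ∉ H) → p v ≡ 0ℚ →
                   IsVertex F p → IsVertex (deleteV v F) (Vector.removeAt p v)
IsVertex-deleteV {F = F} {p} v avoids pᵥ≡0 ((p≥0 , rows) , extreme) =
  InPolyhedron-deleteV v pᵥ≡0 p≥0 (λ H∈F _ → All.lookup rows H∈F) , λ y z Py Pz mid j →
    let lift≗ = extreme (lift y) (lift z) (lift-feasible Py) (lift-feasible Pz) (lift-midpoint mid)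
    in trans (sym (insertAt-punchIn y v 0ℚ j)) (trans (lift≗ (punchIn v j)) (insertAt-punchIn z v 0ℚ j))
  where
  lift : Point _ → Point _
  lift y = Vector.insertAt y v 0ℚ
  lift-feasible : ∀ {y} → InPolyhedron (deleteV v F) y → InPolyhedron F (lift y)
  lift-feasible {y} (y≥0 , rows′) =
      ∀-punchIn v (subst (0ℚ ≤_) (sym (insertAt-lookup y v 0ℚ)) (ℚ.≤-refl {0ℚ}))
                  (λ j → subst (0ℚ ≤_) (sym (insertAt-punchIn y v 0ℚ j)) (y≥0 j))
    , All.tabulate λ {H} H∈F →
        subst (1ℚ ≤_) (rowSum-removeAt H v y) (All.lookup rows′ (∈-deleteV⁺ v H∈F (avoids H∈F)))
  lift-midpoint : ∀ {y z} → (∀ j → p (punchIn v j) ≡ ½ * (y j + z j)) →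
                  ∀ i → p i ≡ ½ * (lift y i + lift z i)
  lift-midpoint {y} {z} mid = ∀-punchIn v
    (trans pᵥ≡0 (cong₂ (λ a b → ½ * (a + b)) (sym (insertAt-lookup y v 0ℚ)) (sym (insertAt-lookup z v 0ℚ))))
    (λ j → trans (mid j)
      (cong₂ (λ a b → ½ * (a + b)) (sym (insertAt-punchIn y v 0ℚ j)) (sym (insertAt-punchIn z v 0ℚ j))))

allSubset? : ∀ {n p} {P : Pred (Subset n) p} → Decidable P → Dec (∀ A → P A)
allSubset? {zero}  P? = map′ (λ { P[] [] → P[] }) (λ ∀P → ∀P []) (P? [])
allSubset? {suc n} P? =
  map′ (λ { (P₁ , P₀) (true ∷ A) → P₁ A ; (P₁ , P₀) (false ∷ A) → P₀ A })
       (λ ∀P → ∀P ∘ (inside ∷_) , ∀P ∘ (outside ∷_))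
       (allSubset? (P? ∘ (inside ∷_)) ×-dec allSubset? (P? ∘ (outside ∷_)))

line : Fin 7 → Subset 7
line = fanoLines !_

coLines : List (Subset 7)
coLines = map ∁ fanoLines

linesAndCoLines : List (Subset 7)
linesAndCoLines = fanoLines ++ coLines

unique-fanoLines : Unique fanoLines
unique-fanoLines = from-yes (unique? fanoLines)

line-or-co-line : ∀ A → 3 ≤ℕ ∣ A ∣ → (∣ A ∣ ≡ 3 → A ∈ₗ fanoLines) →
                  All (λ L → L ⊆ A → L ≡ A) fanoLines → A ∈ₗ linesAndCoLines
line-or-co-line = from-yes (allSubset? λ A →
  3 ≤ℕ? ∣ A ∣ →-dec ((∣ A ∣ ≟ 3 →-dec A ∈ₗ? fanoLines) →-dec
  (All.all? (λ L → L ⊆? A →-dec L ≟ˢ A) fanoLines →-dec A ∈ₗ? linesAndCoLines)))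

infixl 6 _+₇_ _-₇_

_+₇_ _-₇_ : Fin 7 → Fin 7 → Fin 7
i +₇ k = (toℕ i +ℕ toℕ k) mod 7
i -₇ k = (toℕ i +ℕ (7 ∸ toℕ k)) mod 7

-₇-+₇ : ∀ k i → i -₇ k +₇ k ≡ i
-₇-+₇ = from-yes (Fin.all? λ k → Fin.all? λ i → i -₇ k +₇ k Fin.≟ i)

+₇--₇ : ∀ k i → i +₇ k -₇ k ≡ i
+₇--₇ = from-yes (Fin.all? λ k → Fin.all? λ i → i +₇ k -₇ k Fin.≟ i)

rotate : Fin 7 → Permutation′ 7
rotate k = permutation (_+₇ k) (_-₇ k) (-₇-+₇ k) (+₇--₇ k)

rotate-lines : ∀ k → All (λ L → relabel (rotate k) L ∈ₗ fanoLines) fanoLines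
rotate-lines = from-yes (Fin.all? λ k → All.all? (λ L → relabel (rotate k) L ∈ₗ? fanoLines) fanoLines)

rotate⁻¹-linesAndCoLines : ∀ k → All (λ A → relabel (flip (rotate k)) A ∈ₗ linesAndCoLines) linesAndCoLines
rotate⁻¹-linesAndCoLines = from-yes (Fin.all? λ k →
  All.all? (λ A → relabel (flip (rotate k)) A ∈ₗ? linesAndCoLines) linesAndCoLines)

rotate-co-line₀ : All (λ A → ∃ λ k → relabel (rotate k) (∁ (line 0F)) ≡ A) coLines
rotate-co-line₀ = from-yes (All.all? (λ A → Fin.any? λ k → relabel (rotate k) (∁ (line 0F)) ≟ˢ A) coLines)

-- A fractional vertex once a point of a co-line is deleted

x̂ : Point 7
x̂ 0F = 0ℚ
x̂ 1F = 1ℚ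
x̂ 2F = 0ℚ
x̂ 3F = ½
x̂ 4F = 0ℚ
x̂ 5F = ½
x̂ 6F = ½

tightRows : Family 7
tightRows = line 1F ∷ line 2F ∷ line 3F ∷ ∁ (line 0F) ∷ []

x̂-nonneg : ∀ i → 0ℚ ≤ x̂ i
x̂-nonneg = from-yes (Fin.all? λ i → 0ℚ ℚ.≤? x̂ i)

x̂-covers : All (λ A → 0F ∉ A → 1ℚ ≤ rowSum A x̂) linesAndCoLines
x̂-covers = from-yes (All.all? (λ A → ¬? (0F ∈? A) →-dec 1ℚ ℚ.≤? rowSum A x̂) linesAndCoLines)

x̂-tight : All (λ H → rowSum H x̂ ≡ 1ℚ) tightRows
x̂-tight = refl ∷ refl ∷ refl ∷ refl ∷ []

tightRows-avoid-0 : All (0F ∉_) tightRows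
tightRows-avoid-0 = from-yes (All.all? (λ T → ¬? (0F ∈? T)) tightRows)

tightRows-unique : ∀ (w : Point 7) → w 0F ≡ 0ℚ → w 2F ≡ 0ℚ → w 4F ≡ 0ℚ →
                   All (λ H → rowSum H w ≡ 1ℚ) tightRows → ∀ i → w i ≡ x̂ i
tightRows-unique w w₀≡0 w₂≡0 w₄≡0 (r₁ ∷ r₂ ∷ r₃ ∷ r₀ ∷ []) = λ where
    0F → w₀≡0
    1F → trans (solve 3 (λ a₁ a₂ a₄ → a₁ := a₁ :+ a₂ :+ a₄ :- a₂ :- a₄) refl w₁ w₂ w₄)
               (cong₂ _-_ (cong₂ _-_ s₁ w₂≡0) w₄≡0)
    2F → w₂≡0
    3F → trans (solve 5 (λ a₂ a₃ a₄ a₅ a₆ →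
                 a₃ := con ½ :* ((a₂ :+ a₃ :+ a₅) :+ (a₃ :+ a₄ :+ a₆) :- (a₂ :+ a₄ :+ a₅ :+ a₆)))
                 refl w₂ w₃ w₄ w₅ w₆)
               (cong (½ *_) (cong₂ _-_ (cong₂ _+_ s₂ s₃) s₀))
    4F → w₄≡0
    5F → trans (solve 5 (λ a₂ a₃ a₄ a₅ a₆ →
                 a₅ := con ½ :* ((a₂ :+ a₃ :+ a₅) :+ (a₂ :+ a₄ :+ a₅ :+ a₆) :- (a₃ :+ a₄ :+ a₆)) :- a₂)
                 refl w₂ w₃ w₄ w₅ w₆)
               (cong₂ (λ t u → ½ * t - u) (cong₂ _-_ (cong₂ _+_ s₂ s₀) s₃) w₂≡0)
    6F → trans (solve 5 (λ a₂ a₃ a₄ a₅ a₆ →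
                 a₆ := con ½ :* ((a₃ :+ a₄ :+ a₆) :+ (a₂ :+ a₄ :+ a₅ :+ a₆) :- (a₂ :+ a₃ :+ a₅)) :- a₄)
                 refl w₂ w₃ w₄ w₅ w₆)
               (cong₂ (λ t u → ½ * t - u) (cong₂ _-_ (cong₂ _+_ s₃ s₀) s₂) w₄≡0)
  where
  open +-*-Solver
  w₁ w₂ w₃ w₄ w₅ w₆ : ℚ
  w₁ = w 1F; w₂ = w 2F; w₃ = w 3F; w₄ = w 4F; w₅ = w 5F; w₆ = w 6F
  -- Each right-hand side is rowSum of a tight row, unfolded.
  s₁ : w₁ + w₂ + w₄ ≡ 1ℚ
  s₁ = trans (solve 3 (λ a₁ a₂ a₄ → a₁ :+ a₂ :+ a₄ :=
         con 0ℚ :+ (a₁ :+ (a₂ :+ (con 0ℚ :+ (a₄ :+ (con 0ℚ :+ (con 0ℚ :+ con 0ℚ))))))) refl w₁ w₂ w₄) r₁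
  s₂ : w₂ + w₃ + w₅ ≡ 1ℚ
  s₂ = trans (solve 3 (λ a₂ a₃ a₅ → a₂ :+ a₃ :+ a₅ :=
         con 0ℚ :+ (con 0ℚ :+ (a₂ :+ (a₃ :+ (con 0ℚ :+ (a₅ :+ (con 0ℚ :+ con 0ℚ))))))) refl w₂ w₃ w₅) r₂
  s₃ : w₃ + w₄ + w₆ ≡ 1ℚ
  s₃ = trans (solve 3 (λ a₃ a₄ a₆ → a₃ :+ a₄ :+ a₆ :=
         con 0ℚ :+ (con 0ℚ :+ (con 0ℚ :+ (a₃ :+ (a₄ :+ (con 0ℚ :+ (a₆ :+ con 0ℚ))))))) refl w₃ w₄ w₆) r₃
  s₀ : w₂ + w₄ + w₅ + w₆ ≡ 1ℚ
  s₀ = trans (solve 4 (λ a₂ a₄ a₅ a₆ → a₂ :+ a₄ :+ a₅ :+ a₆ :=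
         con 0ℚ :+ (con 0ℚ :+ (a₂ :+ (con 0ℚ :+ (a₄ :+ (a₅ :+ (a₆ :+ con 0ℚ))))))) refl w₂ w₄ w₅ w₆) r₀

x̂-vertex : IsVertex tightRows x̂
x̂-vertex = tight-unique⇒IsVertex (x̂-nonneg , All.map ℚ.≤-reflexive (All.map sym x̂-tight))
  λ w _ zeros tight → tightRows-unique w (zeros 0F refl) (zeros 2F refl) (zeros 4F refl)
                                       (All.tabulate λ H∈ → tight H∈ (All.lookup x̂-tight H∈))

module _ (F : Family 7) (σ : Permutation′ 7)
         (F⊆linesAndCoLines : F ⊆ₗ map (relabel σ) linesAndCoLines)
         (tightRows⊆F : map (relabel σ) tightRows ⊆ₗ F) where

  private
    v : Fin 7
    v = σ ⟨$⟩ʳ 0F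

    q : Point 7
    q = x̂ ∘ (σ ⟨$⟩ˡ_)

    qᵥ≡0 : q v ≡ 0ℚ
    qᵥ≡0 = cong x̂ (inverseˡ σ)

    x : Point 6
    x = Vector.removeAt q v

    -- The list is passed to ∈-map⁻ explicitly (here and below): otherwise Agda unfolds it and
    -- cannot invert map.
    covered : ∀ {H} → H ∈ₗ F → v ∉ H → 1ℚ ≤ rowSum H q
    covered H∈F v∉H with A , A∈ , refl ← ∈-map⁻ (relabel σ) {xs = linesAndCoLines} (F⊆linesAndCoLines H∈F) =
      subst (1ℚ ≤_) (sym (rowSum-relabel-⟨$⟩ˡ σ A x̂)) (All.lookup x̂-covers A∈ (v∉H ∘ ∈-relabel⁺ σ))

    avoids : ∀ {H} → H ∈ₗ map (relabel σ) tightRows → v ∉ H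
    avoids H∈ with T , T∈ , refl ← ∈-map⁻ (relabel σ) {xs = tightRows} H∈ =
      All.lookup tightRows-avoid-0 T∈ ∘ ∈-relabel⁻ σ

    x-vertex : IsVertex (deleteV v F) x
    x-vertex = IsVertex-⊆ (deleteV-mono v tightRows⊆F)
      (InPolyhedron-deleteV v qᵥ≡0 (x̂-nonneg ∘ (σ ⟨$⟩ˡ_)) covered)
      (IsVertex-deleteV v avoids qᵥ≡0 (IsVertex-relabel σ x̂-vertex))

    v≢σ3 : v ≢ σ ⟨$⟩ʳ 3F
    v≢σ3 eq with () ← trans (sym (inverseˡ σ)) (trans (cong (σ ⟨$⟩ˡ_) eq) (inverseˡ σ))

    x≡½ : x (punchOut v≢σ3) ≡ ½
    x≡½ = trans (removeAt-punchOut q v≢σ3) (cong x̂ (inverseˡ σ))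

  deleteV-nonideal : ¬ Ideal (deleteV v F)
  deleteV-nonideal ideal = ½≢integer (proj₁ integral) (trans (sym x≡½) (proj₂ integral))
    where
    integral : ∃ λ k → x (punchOut v≢σ3) ≡ k / 1
    integral = ideal x x-vertex (punchOut v≢σ3)

module _ (C : Clutter 7) (σ : Permutation′ 7)
         (core⇒line : ∀ H → InCore (Clutter.edges C) H → ∃ λ L → L ∈ₗ fanoLines × H ≡ relabel σ L)
         (line⇒core : ∀ L → L ∈ₗ fanoLines → InCore (Clutter.edges C) (relabel σ L)) where

  open Clutter C

  private
    line∈edges : ∀ {L} → L ∈ₗ fanoLines → relabel σ L ∈ₗ edges
    line∈edges L∈ = proj₁ (line⇒core _ L∈)

    3≤∣edge∣ : ∀ {E} → E ∈ₗ edges → 3 ≤ℕ ∣ E ∣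
    3≤∣edge∣ {E} E∈ =
      subst (_≤ℕ ∣ E ∣) (∣relabel∣ σ (line 0F)) (proj₂ (line⇒core (line 0F) (here refl)) E∈)

    core-edge⇒line : ∀ {E} → E ∈ₗ edges → ∣ E ∣ ≡ 3 → relabel (flip σ) E ∈ₗ fanoLines
    core-edge⇒line {E} E∈ ∣E∣≡3 =
      let L , L∈ , E≡σL = core⇒line E (E∈ , λ E′∈ → subst (_≤ℕ _) (sym ∣E∣≡3) (3≤∣edge∣ E′∈))
      in subst (_∈ₗ fanoLines) (sym (trans (cong (relabel (flip σ)) E≡σL) (relabel-flip σ L))) L∈

    line⊆edge⇒≡ : ∀ {E L} → E ∈ₗ edges → L ∈ₗ fanoLines →
                  L ⊆ relabel (flip σ) E → L ≡ relabel (flip σ) E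
    line⊆edge⇒≡ {E} {L} E∈ L∈ L⊆σ⁻¹E =
      relabel-injective σ (trans (antichain (line∈edges L∈) E∈ σL⊆E) (sym (relabel-flip′ σ E)))
      where
      σL⊆E : relabel σ L ⊆ E
      σL⊆E = subst (relabel σ L ⊆_) (relabel-flip′ σ E) (relabel-mono σ L⊆σ⁻¹E)

  edges⊆linesAndCoLines : edges ⊆ₗ map (relabel σ) linesAndCoLines
  edges⊆linesAndCoLines {E} E∈ = subst (_∈ₗ map (relabel σ) linesAndCoLines) (relabel-flip′ σ E)
    (∈-map⁺ (relabel σ) (line-or-co-line (relabel (flip σ) E)
      (subst (3 ≤ℕ_) (sym (∣relabel∣ (flip σ) E)) (3≤∣edge∣ E∈))
      (core-edge⇒line E∈ ∘ trans (sym (∣relabel∣ (flip σ) E)))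
      (All.tabulate (line⊆edge⇒≡ E∈))))

  module _ (deletions-ideal : ∀ v → Ideal (deleteV v edges)) where

    rotated-co-line₀∉edges : ∀ k → relabel σ (relabel (rotate k) (∁ (line 0F))) ∈ₗ edges → ⊥
    rotated-co-line₀∉edges k σρ∁ℓ₀∈ =
      deleteV-nonideal edges σ′ edges⊆rotated tightRows⊆edges (deletions-ideal _)
      where
      ρ σ′ : Permutation′ 7
      ρ = rotate k
      σ′ = ρ ∘ₚ σ
      edges⊆rotated : edges ⊆ₗ map (relabel σ′) linesAndCoLines
      edges⊆rotated E∈ =
        let B , B∈ , E≡σB = ∈-map⁻ (relabel σ) {xs = linesAndCoLines} (edges⊆linesAndCoLines E∈)
        in subst (_∈ₗ map (relabel σ′) linesAndCoLines)
                 (trans (relabel-∘ₚ ρ σ (relabel (flip ρ) B))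
                        (trans (cong (relabel σ) (relabel-flip′ ρ B)) (sym E≡σB)))
                 (∈-map⁺ (relabel σ′) (All.lookup (rotate⁻¹-linesAndCoLines k) B∈))
      rotated-line∈edges : ∀ {L} → L ∈ₗ fanoLines → relabel σ′ L ∈ₗ edges
      rotated-line∈edges {L} L∈ =
        subst (_∈ₗ edges) (sym (relabel-∘ₚ ρ σ L)) (line∈edges (All.lookup (rotate-lines k) L∈))
      tightRows⊆edges : map (relabel σ′) tightRows ⊆ₗ edges
      tightRows⊆edges (here refl)                         = rotated-line∈edges (there (here refl))
      tightRows⊆edges (there (here refl))                 = rotated-line∈edges (there (there (here refl)))
      tightRows⊆edges (there (there (here refl)))         = rotated-line∈edges (there (there (there (here refl))))
      tightRows⊆edges (there (there (there (here refl)))) =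
        subst (_∈ₗ edges) (sym (relabel-∘ₚ ρ σ (∁ (line 0F)))) σρ∁ℓ₀∈

    co-line∉edges : ∀ {A} → A ∈ₗ coLines → relabel σ A ∈ₗ edges → ⊥
    co-line∉edges A∈ σA∈ =
      let k , ρ∁ℓ₀≡A = All.lookup rotate-co-line₀ A∈
      in rotated-co-line₀∉edges k (subst (λ B → relabel σ B ∈ₗ edges) (sym ρ∁ℓ₀≡A) σA∈)

    edges⊆lines : edges ⊆ₗ map (relabel σ) fanoLines
    edges⊆lines E∈ =
      let A , A∈ , E≡σA = ∈-map⁻ (relabel σ) {xs = linesAndCoLines} (edges⊆linesAndCoLines E∈)
      in [ (λ A∈lines → subst (_∈ₗ map (relabel σ) fanoLines) (sym E≡σA) (∈-map⁺ (relabel σ) A∈lines))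
         , (λ A∈coLines → ⊥-elim (co-line∉edges A∈coLines (subst (_∈ₗ edges) E≡σA E∈)))
         ]′ (∈-++⁻ fanoLines A∈)

    lines⊆edges : map (relabel σ) fanoLines ⊆ₗ edges
    lines⊆edges E∈ =
      let L , L∈ , E≡σL = ∈-map⁻ (relabel σ) {xs = fanoLines} E∈
      in subst (_∈ₗ edges) (sym E≡σL) (line∈edges L∈)

    length-edges≡7 : length edges ≡ 7
    length-edges≡7 = ↭-length (∼bag⇒↭ (unique∧set⇒bag distinct
      (Unique.map⁺ (relabel-injective σ) unique-fanoLines) (mk⇔ edges⊆lines lines⊆edges)))

theorem6p4 : ∀ {n} (C : Clutter n) →
    MinimallyNonideal (Clutter.edges C) →
    CoreIsFano (Clutter.edges C) →
    length (Clutter.edges C) ≡ n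
theorem6p4 C (_ , minors-ideal) (σ , core⇒line , line⇒core) with refl ← ↔⇒≡ σ =
  length-edges≡7 C σ core⇒line line⇒core λ v → minors-ideal _ (del (Clutter.edges C) v)
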